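{- Let $\langle(\mathsf{K}_\Phi)_{\Phi\subseteq\mathsf{At}},(f^\Phi_\Psi)_{\Psi\subseteq\Phi\subseteq\mathsf{At}}\rangle$ be a category of FH models. Modal equivalence relative to sublanguages forms a complete lattice on the FH models of the category as follows: for any non-empty $\mathcal{F}\subseteq2^{\mathsf{At}}$, writing $\Phi^\cup=\bigcup_{\Phi\in\mathcal{F}}\Phi$ and $\Phi^\cap=\bigcap_{\Phi\in\mathcal{F}}\Phi$, (i) for every $\Psi\in\mathcal{F}$, every $w\in W_{\Phi^\cup}$ and every $\varphi\in\mathcal{L}_\Psi$: $\mathsf{K}_{\Phi^\cup},w\Vdash\varphi$ iff $\mathsf{K}_\Psi,f^{\Phi^\cup}_\Psi(w)\Vdash\varphi$; and (ii) for every $\Psi\in\mathcal{F}$, every $w\in W_\Psi$ and every $\varphi\in\mathcal{L}_{\Phi^\cap}$: $\mathsf{K}_\Psi,w\Vdash\varphi$ iff $\mathsf{K}_{\Phi^\cap},f^\Psi_{\Phi^\cap}(w)\Vdash\varphi$.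
   Context: Fix non-empty sets $\mathsf{At}$ (atoms) and $I$ (individuals). Language $\mathcal{L}_{\mathsf{At}}$: $\varphi::=\top\mid p\mid\neg\varphi\mid\varphi\wedge\psi\mid\ell_i\varphi\mid a_i\varphi\mid k_i\varphi$; $\mathsf{At}(\varphi)$ = atoms in $\varphi$; $\mathcal{L}_\Phi=\{\varphi:\mathsf{At}(\varphi)\subseteq\Phi\}$. FH model for $\Phi$: $\mathsf{K}_\Phi=\langle I,W_\Phi,(R_{\Phi,i}),(\mathcal{A}_{\Phi,i}),V_\Phi\rangle$ with $W_\Phi\ne\emptyset$, $R_{\Phi,i}$ equivalence relations, $\mathcal{A}_{\Phi,i}:W_\Phi\to2^{\mathcal{L}_\Phi}$ such that $\varphi\in\mathcal{A}_{\Phi,i}(w)$ iff all $p\in\mathsf{At}(\varphi)$ are in $\mathcal{A}_{\Phi,i}(w)$, and $(w,t)\in R_{\Phi,i}\Rightarrow\mathcal{A}_{\Phi,i}(w)=\mathcal{A}_{\Phi,i}(t)$; $V_\Phi:\Phi\to2^{W_\Phi}$. Satisfaction for $\varphi\in\mathcal{L}_\Phi$: $\top$ always; $p$ iff $w\in V_\Phi(p)$; Boolean usual; $a_i\varphi$ iff $\varphi\in\mathcal{A}_{\Phi,i}(w)$; $\ell_i\varphi$ iff $\varphi$ holds at all $t$ with $(w,t)\in R_{\Phi,i}$; $k_i\varphi$ abbreviates $\ell_i\varphi\wedge a_i\varphi$. Surjective bounded morphism $f^\Phi_\Psi$ ($\Psi\subseteq\Phi$): surjection $W_\Phi\to W_\Psi$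 with $w\in V_\Phi(p)\iff f^\Phi_\Psi(w)\in V_\Psi(p)$ ($p\in\Psi$); $\mathcal{A}_{\Phi,i}(w)\cap\mathcal{L}_\Psi=\mathcal{A}_{\Psi,i}(f^\Phi_\Psi(w))$; $(w,t)\in R_{\Phi,i}\Rightarrow(f^\Phi_\Psi(w),f^\Phi_\Psi(t))\in R_{\Psi,i}$; if $(f^\Phi_\Psi(w),t')\in R_{\Psi,i}$ there is $t$ with $f^\Phi_\Psi(t)=t'$ and $(w,t)\in R_{\Phi,i}$. A category of FH models consists of one FH model $\mathsf{K}_\Phi$ for each $\Phi\subseteq\mathsf{At}$ and one surjective bounded morphism $f^\Phi_\Psi$ for each $\Psi\subseteq\Phi$, with $f^\Phi_\Phi=\mathrm{id}$ and $f^\Phi_\Upsilon=f^\Psi_\Upsilon\circ f^\Phi_\Psi$ for $\Upsilon\subseteq\Psi\subseteq\Phi$. -}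

module Defs where

open import Data.Product using (Σ; _×_; _,_; ∃)
open import Data.Unit using (⊤)
open import Data.Empty using (⊥)
open import Function.Bundles using (_⇔_)
open import Relation.Binary.PropositionalEquality using (_≡_)
open import Relation.Binary.Structures using (IsEquivalence)

Subset : Set → Set₁
Subset At = At → Set

_⊆_ : {At : Set} → Subset At → Subset At → Set
Ψ ⊆ Φ = ∀ {p} → Ψ p → Φ p

data Form (At I : Set) : Set where
  top  : Form At I
  atom : At → Form At I
  neg  : Form At I → Form At I
  and  : Form At I → Form At I → Form At I
  ℓₒ   : I → Form At I → Form At I
  aₒ   : I → Form At I → Form At I

kₒ : {At I : Set} → I → Form At I → Form At I
kₒ i φ = and (ℓₒ i φ) (aₒ i φ)

AllAtoms : {At I : Set} → (At → Set) → Form At I → Set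
AllAtoms P top       = ⊤
AllAtoms P (atom p)  = P p
AllAtoms P (neg φ)   = AllAtoms P φ
AllAtoms P (and φ ψ) = AllAtoms P φ × AllAtoms P ψ
AllAtoms P (ℓₒ i φ)  = AllAtoms P φ
AllAtoms P (aₒ i φ)  = AllAtoms P φ

InLang : {At I : Set} → Subset At → Form At I → Set
InLang Φ φ = AllAtoms Φ φ

-- FH model for Φ.  The valuation is given on all atoms, but only its
-- restriction to Φ is ever used (satisfaction is only considered for φ ∈ L_Φ).
record FHModel {At I : Set} (Φ : Subset At) : Set₁ where
  field
    W        : Set
    W-nonempty : W
    R        : I → W → W → Set
    R-equiv  : ∀ i → IsEquivalence (R i)
    A        : I → W → Form At I → Set
    A-lang   : ∀ i w φ → A i w φ → InLang Φ φ
    A-atoms  : ∀ i w φ → InLang Φ φ → (A i w φ ⇔ AllAtoms (λ p → A i w (atom p)) φ)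
    A-R      : ∀ i w t → R i w t → ∀ φ → (A i w φ ⇔ A i t φ)
    V        : At → W → Set

module _ {At I : Set} {Φ : Subset At} (K : FHModel {At} {I} Φ) where
  open FHModel K
  Sat : W → Form At I → Set
  Sat w top       = ⊤
  Sat w (atom p)  = V p w
  Sat w (neg φ)   = Sat w φ → ⊥
  Sat w (and φ ψ) = Sat w φ × Sat w ψ
  Sat w (ℓₒ i φ)  = ∀ t → R i w t → Sat t φ
  Sat w (aₒ i φ)  = A i w φ

record IsSBM {At I : Set} {Φ Ψ : Subset At}
             (KΦ : FHModel {At} {I} Φ) (KΨ : FHModel {At} {I} Ψ)
             (f : FHModel.W KΦ → FHModel.W KΨ) : Set₁ where
  module KΦ = FHModel KΦ
  module KΨ = FHModel KΨ
  field
    surj  : ∀ t′ → ∃ λ w → f w ≡ t′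
    val   : ∀ p → Ψ p → ∀ w → (KΦ.V p w ⇔ KΨ.V p (f w))
    aware : ∀ i w φ → ((KΦ.A i w φ × InLang Ψ φ) ⇔ KΨ.A i (f w) φ)
    forth : ∀ i w t → KΦ.R i w t → KΨ.R i (f w) (f t)
    back  : ∀ i w t′ → KΨ.R i (f w) t′ → ∃ λ t → (f t ≡ t′) × KΦ.R i w t

record FHCategory (At I : Set) : Set₂ where
  field
    K     : (Φ : Subset At) → FHModel {At} {I} Φ
    f     : {Φ Ψ : Subset At} → Ψ ⊆ Φ → FHModel.W (K Φ) → FHModel.W (K Ψ)
    f-sbm : {Φ Ψ : Subset At} (h : Ψ ⊆ Φ) → IsSBM (K Φ) (K Ψ) (f {Φ} {Ψ} h)
    f-id  : (Φ : Subset At) (h : Φ ⊆ Φ) → ∀ w → f {Φ} {Φ} h w ≡ w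
    f-∘   : {Φ Ψ Υ : Subset At} (hΥΨ : Υ ⊆ Ψ) (hΨΦ : Ψ ⊆ Φ) (hΥΦ : Υ ⊆ Φ) →
            ∀ w → f {Φ} {Υ} hΥΦ w ≡ f {Ψ} {Υ} hΥΨ (f {Φ} {Ψ} hΨΦ w)

⋃ : {At J : Set} → (J → Subset At) → Subset At
⋃ {J = J} F p = Σ J (λ j → F j p)

⋂ : {At J : Set} → (J → Subset At) → Subset At
⋂ {J = J} F p = ∀ j → F j p

⊆⋃ : {At J : Set} (F : J → Subset At) (j : J) → F j ⊆ ⋃ F
⊆⋃ F j h = j , h

⋂⊆ : {At J : Set} (F : J → Subset At) (j : J) → ⋂ F ⊆ F j
⋂⊆ F j h = h j

-- Both parts are instances of one fact: a bounded morphism from K_Φ to K_Ψ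
-- preserves and reflects truth of every formula of L_Ψ.  By induction on the
-- formula, ℓᵢ is handled by the forth and back clauses and aᵢ by the
-- awareness clause.
module Submission where

open import Defs
open import Data.Product using (_×_; _,_; proj₁)
open import Data.Product.Function.NonDependent.Propositional using (_×-⇔_)
open import Function.Bundles using (_⇔_; mk⇔; Equivalence)
open import Function.Construct.Identity using (⇔-id)
open import Function.Related.TypeIsomorphisms using (¬-cong-⇔)
open import Relation.Binary.PropositionalEquality using (refl)

open Equivalence using (to; from)

module _ {At I : Set} {Φ Ψ : Subset At}
         {KΦ : FHModel {At} {I} Φ} {KΨ : FHModel {At} {I} Ψ}
         {f : FHModel.W KΦ → FHModel.W KΨ} (S : IsSBM KΦ KΨ f) where
  open IsSBM S

  Sat-invariant : ∀ w φ → InLang Ψ φ → Sat KΦ w φ ⇔ Sat KΨ (f w) φ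
  Sat-invariant w top       _          = ⇔-id _
  Sat-invariant w (atom p)  p∈Ψ        = val p p∈Ψ w
  Sat-invariant w (neg φ)   φ∈Ψ        = ¬-cong-⇔ (Sat-invariant w φ φ∈Ψ)
  Sat-invariant w (and φ ψ) (φ∈Ψ , ψ∈Ψ) =
    Sat-invariant w φ φ∈Ψ ×-⇔ Sat-invariant w ψ ψ∈Ψ
  Sat-invariant w (ℓₒ i φ)  φ∈Ψ        = mk⇔ forth-□ back-□
    where
    forth-□ : Sat KΦ w (ℓₒ i φ) → Sat KΨ (f w) (ℓₒ i φ)
    forth-□ □φ t′ fwRt′ with back i w t′ fwRt′
    ... | t , refl , wRt = to (Sat-invariant t φ φ∈Ψ) (□φ t wRt)

    back-□ : Sat KΨ (f w) (ℓₒ i φ) → Sat KΦ w (ℓₒ i φ)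
    back-□ □φ t wRt = from (Sat-invariant t φ φ∈Ψ) (□φ (f t) (forth i w t wRt))
  Sat-invariant w (aₒ i φ)  φ∈Ψ        =
    mk⇔ (λ aφ → to (aware i w φ) (aφ , φ∈Ψ)) (λ aφ → proj₁ (from (aware i w φ) aφ))

proposition6 : (At I : Set) → At → I → (C : FHCategory At I) →
    (J : Set) → J → (F : J → Subset At) →
    ((j : J) → (w : FHModel.W (FHCategory.K C (⋃ F))) → (φ : Form At I) →
        InLang (F j) φ →
        (Sat (FHCategory.K C (⋃ F)) w φ
          ⇔ Sat (FHCategory.K C (F j)) (FHCategory.f C (⊆⋃ F j) w) φ))
    × ((j : J) → (w : FHModel.W (FHCategory.K C (F j))) → (φ : Form At I) →
        InLang (⋂ F) φ →
        (Sat (FHCategory.K C (F j)) w φ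
          ⇔ Sat (FHCategory.K C (⋂ F)) (FHCategory.f C (⋂⊆ F j) w) φ))
proposition6 At I _ _ C J _ F =
    (λ j → Sat-invariant (f-sbm (⊆⋃ F j)))
  , (λ j → Sat-invariant (f-sbm (⋂⊆ F j)))
  where open FHCategory C
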